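{- Let $k\ge 1$. Given a parking preference, all of its rearrangements are $k$-Naples parking functions if and only if its weakly increasing (ascending) rearrangement is a $k$-Naples parking function.
   Context: There are $n$ parking spots $1,\dots,n$ on a one-way street and cars $c_1,\dots,c_n$ arrive in order. A parking preference of length $n$ is a sequence $(a_1,\dots,a_n)\in[n]^n$, $a_j$ being the preferred spot of $c_j$. $k$-Naples rule: car $c_j$ parks in spot $a_j$ if it is empty; otherwise it checks spots $a_j-1,\dots,a_j-k$ (only those $\ge1$) in this order and parks in the first empty one; if all are occupied, it drives forward from $a_j$ and parks in the first empty spot after $a_j$; if none exists, it fails to park. The preference is a $k$-Naples parking function if all cars park. A rearrangement is any permutation of the entries of the sequence. -}

module Defs where

open import Data.Nat using (ℕ; zero; suc; _+_; _∸_; _≤_; _<_; _≤ᵇ_)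
open import Data.Bool using (Bool; true; false; if_then_else_; _∧_; not)
open import Data.List using (List; []; _∷_; length)
open import Data.List.Membership.DecPropositional (Data.Nat._≟_) using (_∈?_)
open import Data.List.Relation.Unary.All using (All)
open import Data.Maybe using (Maybe; just; nothing)
open import Relation.Nullary.Decidable using (does)
open import Data.Product using (_×_)
open import Relation.Binary.PropositionalEquality using (_≡_)

-- Spots are 1..n. The set of occupied spots is a list of naturals.
occupied : List ℕ → ℕ → Bool
occupied occ s = does (s ∈? occ)

free : ℕ → List ℕ → ℕ → Bool
free n occ s = (1 ≤ᵇ s) ∧ (s ≤ᵇ n) ∧ not (occupied occ s)

backStep : ℕ → List ℕ → ℕ → ℕ → Maybe ℕ
backStep n occ zero r = nothing
backStep n occ (suc s) zero = nothing
backStep n occ (suc s) (suc r) =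
  if free n occ (suc s) then just (suc s) else backStep n occ s r

forwardStep : ℕ → List ℕ → ℕ → ℕ → Maybe ℕ
forwardStep n occ s zero = nothing
forwardStep n occ s (suc r) =
  if free n occ s then just s else forwardStep n occ (suc s) r

parkSpot : ℕ → ℕ → List ℕ → ℕ → Maybe ℕ
parkSpot k n occ a with free n occ a
... | true = just a
... | false with backStep n occ (a ∸ 1) k
...   | just s = just s
...   | nothing = forwardStep n occ (suc a) (n ∸ a)

parkAll : ℕ → ℕ → List ℕ → List ℕ → Bool
parkAll k n occ [] = true
parkAll k n occ (a ∷ as) with parkSpot k n occ a
... | nothing = false
... | just s = parkAll k n (s ∷ occ) as

InRange : ℕ → ℕ → Set
InRange n a = 1 ≤ a × a ≤ n

IsPreference : ℕ → List ℕ → Set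
IsPreference n α = length α ≡ n × All (InRange n) α

IsNaplesPF : ℕ → ℕ → List ℕ → Set
IsNaplesPF k n α = parkAll k n [] α ≡ true

{-# OPTIONS --safe #-}
-- Only the converse needs proof. Call an occupancy T sparser than S when, for every u, T has at
-- most as many occupied spots among u, …, n as S. Under the k-Naples rule a car preferring a takes
-- the nearest free spot going down from a to a - k, or else the first free spot above a; a
-- counting argument on these two cases shows that a car parking from S also parks from any
-- sparser T, and the two resulting occupancies are again related. Hence if p ≤ q and cars with
-- preferences p, q park in this order, they also park in the order q, p. Every rearrangement of
-- the ascending sequence arises by moving its least entry to the right past larger ones and
-- recursing, so all rearrangements park.
module Submission where

open import Defs
open import Data.Bool using (true; false; if_then_else_) renaming (T to IsTrue)
open import Data.Bool.Properties using (∧-zeroʳ)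
open import Data.Empty using (⊥-elim)
open import Data.List using (List; []; _∷_; _++_)
open import Data.List.Membership.Propositional.Properties using (∈-∃++)
open import Data.List.Relation.Binary.Permutation.Propositional
  using (_↭_; ↭-refl; ↭-sym; ↭-trans; ↭-swap)
open import Data.List.Relation.Binary.Permutation.Propositional.Properties
  using (∈-resp-↭; All-resp-↭; drop-mid; ↭-empty-inv)
open import Data.List.Relation.Unary.All using (All; []; _∷_)
open import Data.List.Relation.Unary.All.Properties using (++⁻ˡ)
open import Data.List.Relation.Unary.AllPairs using (AllPairs; []; _∷_)
open import Data.List.Relation.Unary.Any using (here)
open import Data.List.Relation.Unary.Linked.Properties using (Linked⇒AllPairs)
open import Data.Maybe using (just; nothing)
open import Data.Nat
open import Data.Nat.Properties
open import Data.List.Membership.DecPropositional _≟_ using (_∈?_)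
open import Data.List.Relation.Unary.Sorted.TotalOrder ≤-totalOrder using (Sorted)
open import Data.Product using (_×_; _,_; ∃-syntax)
open import Data.Sum using (inj₁; inj₂)
open import Function.Bundles using (_⇔_; mk⇔)
open import Relation.Nullary using (¬_; yes; no; contradiction)
open import Relation.Nullary.Decidable using (dec-true; dec-false)
open import Relation.Binary.PropositionalEquality

private
  variable
    S T X Y : List ℕ
    l h : ℕ

module _ (n : ℕ) where

  -- A record rather than the bare equation, so that X and y can be inferred from a proof.
  record Taken (X : List ℕ) (y : ℕ) : Set where
    constructor taken
    field free≡false : free n X y ≡ false

  Free : List ℕ → ℕ → Set
  Free X y = ¬ Taken X y

  free≡true⇒Free : ∀ {y} → free n X y ≡ true → Free X y
  free≡true⇒Free f (taken t) with () ← trans (sym f) t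

  Free⇒free≡true : ∀ {y} → Free X y → free n X y ≡ true
  Free⇒free≡true {X} {y} fy with free n X y in e
  ... | true  = refl
  ... | false = contradiction (taken e) fy

  free-resp-↭ : X ↭ Y → ∀ y → free n X y ≡ free n Y y
  free-resp-↭ {X} {Y} X↭Y y with y ∈? X | y ∈? Y
  ... | yes _   | yes _   = refl
  ... | no  _   | no  _   = refl
  ... | yes y∈X | no  y∉Y = contradiction (∈-resp-↭ X↭Y y∈X) y∉Y
  ... | no  y∉X | yes y∈Y = contradiction (∈-resp-↭ (↭-sym X↭Y) y∈Y) y∉X

  free-∷-≢ : ∀ X {y z} → y ≢ z → free n (z ∷ X) y ≡ free n X y
  free-∷-≢ X {y} {z} y≢z rewrite dec-false (y ≟ z) y≢z = refl

  free-∷-self : ∀ X z → free n (z ∷ X) z ≡ false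
  free-∷-self X z rewrite dec-true (z ≟ z) refl | ∧-zeroʳ (z ≤ᵇ n) = ∧-zeroʳ _

  Taken-∷-self : ∀ {z} → Taken (z ∷ X) z
  Taken-∷-self {X} {z} = taken (free-∷-self X z)

  Taken-∷ : ∀ {y z} → Taken X y → Taken (z ∷ X) y
  Taken-∷ {X} {y} {z} (taken t) with y ≟ z
  ... | yes refl = Taken-∷-self
  ... | no  y≢z  = taken (trans (free-∷-≢ X y≢z) t)

  Free-∷ : ∀ {y z} → y ≢ z → Free X y → Free (z ∷ X) y
  Free-∷ {X} y≢z fy (taken t) = fy (taken (trans (sym (free-∷-≢ X y≢z)) t))

  n<⇒free≡false : ∀ X {y} → n < y → free n X y ≡ false
  n<⇒free≡false X {y} n<y with y ≤ᵇ n in y≤ᵇn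
  ... | true  = contradiction (≤ᵇ⇒≤ y n (subst IsTrue (sym y≤ᵇn) _)) (<⇒≱ n<y)
  ... | false = ∧-zeroʳ (1 ≤ᵇ y)

  n<⇒Taken : ∀ {y} → n < y → Taken X y
  n<⇒Taken {X} n<y = taken (n<⇒free≡false X n<y)

  Free⇒≤n : ∀ {y} → Free X y → y ≤ n
  Free⇒≤n fy = ≮⇒≥ (λ n<y → fy (n<⇒Taken n<y))

  AllTaken : List ℕ → ℕ → ℕ → Set
  AllTaken X l h = ∀ {y} → l ≤ y → y < h → Taken X y

  AllTaken-empty : AllTaken X l l
  AllTaken-empty l≤y y<l = contradiction l≤y (<⇒≱ y<l)

  AllTaken-single : Taken X l → AllTaken X l (suc l)
  AllTaken-single t l≤y y<1+l with refl ← ≤-antisym l≤y (s≤s⁻¹ y<1+l) = t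

  AllTaken-join : ∀ {m} → AllTaken X l m → AllTaken X m h → AllTaken X l h
  AllTaken-join {m = m} lower upper {y} l≤y y<h with y <? m
  ... | yes y<m = lower l≤y y<m
  ... | no  y≮m = upper (≮⇒≥ y≮m) y<h

  AllTaken-shrink : ∀ {l′ h′} → l ≤ l′ → h′ ≤ h → AllTaken X l h → AllTaken X l′ h′
  AllTaken-shrink l≤l′ h′≤h all l′≤y y<h′ = all (≤-trans l≤l′ l′≤y) (<-≤-trans y<h′ h′≤h)

  AllTaken-extend : AllTaken X l (suc n) → AllTaken X l h
  AllTaken-extend upToN {y} l≤y _ with y ≤? n
  ... | yes y≤n = upToN l≤y (s≤s y≤n)
  ... | no  y≰n = n<⇒Taken (≰⇒> y≰n)

  AllTaken-∷ : ∀ {z} → AllTaken X l h → AllTaken (z ∷ X) l h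
  AllTaken-∷ all l≤y y<h = Taken-∷ (all l≤y y<h)

  backStep-just : ∀ a r {t} → backStep n X (a ∸ 1) r ≡ just t →
                  a ∸ r ≤ t × t < a × AllTaken X (suc t) a × Free X t
  backStep-just {X} (suc (suc a)) (suc r) eq with free n X (suc a) in f
  ... | true with refl ← eq = m∸n≤m (suc a) r , n<1+n (suc a) , AllTaken-empty , free≡true⇒Free f
  ... | false with backStep-just (suc a) r eq
  ...   | a∸r≤t , t<a , gap , ft =
    a∸r≤t , m<n⇒m<1+n t<a , AllTaken-join gap (AllTaken-single (taken f)) , ft

  backStep-nothing : ∀ a r → backStep n X (a ∸ 1) r ≡ nothing → AllTaken X (a ∸ r) a
  backStep-nothing zero          r       _  = λ _ ()
  backStep-nothing (suc zero)    zero    _  = AllTaken-empty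
  backStep-nothing (suc zero)    (suc r) _  = λ { _ (s≤s z≤n) → taken refl }
  backStep-nothing (suc (suc a)) zero    _  = AllTaken-empty
  backStep-nothing {X} (suc (suc a)) (suc r) eq with free n X (suc a) in f
  ... | false = AllTaken-join (backStep-nothing (suc a) r eq) (AllTaken-single (taken f))

  forwardStep-just : ∀ s r {t} → forwardStep n X s r ≡ just t → s ≤ t × AllTaken X s t × Free X t
  forwardStep-just {X} s (suc r) eq with free n X s in f
  ... | true with refl ← eq = ≤-refl , AllTaken-empty , free≡true⇒Free f
  ... | false with forwardStep-just (suc s) r eq
  ...   | s<t , gap , ft = <⇒≤ s<t , AllTaken-join (AllTaken-single (taken f)) gap , ft

  forwardStep-nothing : ∀ s r → forwardStep n X s r ≡ nothing → AllTaken X s (s + r)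
  forwardStep-nothing s zero    _  = AllTaken-shrink ≤-refl (≤-reflexive (+-identityʳ s)) AllTaken-empty
  forwardStep-nothing {X} s (suc r) eq with free n X s in f
  ... | false = AllTaken-join (AllTaken-single (taken f))
                  (AllTaken-shrink ≤-refl (≤-reflexive (+-suc s r)) (forwardStep-nothing (suc s) r eq))

  #taken : List ℕ → ℕ → ℕ → ℕ
  #taken X u zero    = 0
  #taken X u (suc r) = (if free n X u then 0 else 1) + #taken X (suc u) r

  #taken-+ : ∀ X u d r → #taken X u (d + r) ≡ #taken X u d + #taken X (u + d) r
  #taken-+ X u zero    r rewrite +-identityʳ u = refl
  #taken-+ X u (suc d) r rewrite #taken-+ X (suc u) d r | +-suc u d =
    sym (+-assoc (if free n X u then 0 else 1) (#taken X (suc u) d) _)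

  #taken≤ : ∀ X u d → #taken X u d ≤ d
  #taken≤ X u zero    = z≤n
  #taken≤ X u (suc d) with free n X u
  ... | true  = m≤n⇒m≤1+n (#taken≤ X (suc u) d)
  ... | false = s≤s (#taken≤ X (suc u) d)

  #taken-full : ∀ {u} d → AllTaken X u (u + d) → #taken X u d ≡ d
  #taken-full         zero    _    = refl
  #taken-full {u = u} (suc d) full rewrite Taken.free≡false (full ≤-refl (m<m+n u z<s)) =
    cong suc (#taken-full d (AllTaken-shrink (n≤1+n u) (≤-reflexive (sym (+-suc u d))) full))

  #taken< : ∀ {u w} d → Free X w → u ≤ w → w < u + d → #taken X u d < d
  #taken< {u = u} zero fw u≤w w<u+0 = contradiction (subst (_ <_) (+-identityʳ u) w<u+0) (≤⇒≯ u≤w)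
  #taken< {X} {u} (suc d) fw u≤w w<u+d with m≤n⇒m<n∨m≡n u≤w
  ... | inj₂ refl rewrite Free⇒free≡true fw = s≤s (#taken≤ X (suc u) d)
  ... | inj₁ u<w with free n X u
  ...   | true  = m<n⇒m<1+n (#taken< d fw u<w (<-≤-trans w<u+d (≤-reflexive (+-suc u d))))
  ...   | false = s≤s (#taken< d fw u<w (<-≤-trans w<u+d (≤-reflexive (+-suc u d))))

  #taken-resp-↭ : X ↭ Y → ∀ u r → #taken X u r ≡ #taken Y u r
  #taken-resp-↭ X↭Y u zero    = refl
  #taken-resp-↭ X↭Y u (suc r) rewrite free-resp-↭ X↭Y u = cong (_ +_) (#taken-resp-↭ X↭Y (suc u) r)

  #taken-∷-below : ∀ X {z u} r → z < u → #taken (z ∷ X) u r ≡ #taken X u r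
  #taken-∷-below X zero    z<u = refl
  #taken-∷-below X (suc r) z<u rewrite free-∷-≢ X (>⇒≢ z<u) =
    cong (_ +_) (#taken-∷-below X r (m<n⇒m<1+n z<u))

  #taken-∷-inside : ∀ {z u} r → Free X z → u ≤ z → z < u + r → #taken (z ∷ X) u r ≡ suc (#taken X u r)
  #taken-∷-inside {u = u} zero fz u≤z z<u+0 =
    contradiction (subst (_ <_) (+-identityʳ u) z<u+0) (≤⇒≯ u≤z)
  #taken-∷-inside {X} {z} {u} (suc r) fz u≤z z<u+r with m≤n⇒m<n∨m≡n u≤z
  ... | inj₂ refl rewrite free-∷-self X u | Free⇒free≡true fz = cong suc (#taken-∷-below X r (n<1+n u))
  ... | inj₁ u<z rewrite free-∷-≢ X (<⇒≢ u<z) =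
    trans (cong (_ +_) (#taken-∷-inside r fz u<z (<-≤-trans z<u+r (≤-reflexive (+-suc u r)))))
          (+-suc _ _)

  -- Spots above n count as taken, so a window reaching past n measures the tail from u to n.
  Sparser : List ℕ → List ℕ → Set
  Sparser T S = ∀ u r → n < u + r → #taken T u r ≤ #taken S u r

  ↭⇒Sparser : T ↭ S → Sparser T S
  ↭⇒Sparser T↭S u r _ = ≤-reflexive (#taken-resp-↭ T↭S u r)

  Sparser-occupy : ∀ {z} → Free S z → Sparser S (z ∷ S)
  Sparser-occupy {S} {z} fz u r n<u+r with u ≤? z
  ... | yes u≤z rewrite #taken-∷-inside r fz u≤z (≤-<-trans (Free⇒≤n fz) n<u+r) = n≤1+n _
  ... | no  u≰z rewrite #taken-∷-below S r (≰⇒> u≰z) = ≤-refl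

  Sparser-∷ : ∀ {t s} → Sparser T S → Free T t → Free S s →
              (∀ {u r} → s < u → u ≤ t → n < u + r → #taken T u r < #taken S u r) →
              Sparser (t ∷ T) (s ∷ S)
  Sparser-∷ {T} {S} {t} {s} T⊑S ft fs strict u r n<u+r with u ≤? s | u ≤? t
  ... | yes u≤s | yes u≤t
    rewrite #taken-∷-inside r fs u≤s (≤-<-trans (Free⇒≤n fs) n<u+r)
          | #taken-∷-inside r ft u≤t (≤-<-trans (Free⇒≤n ft) n<u+r) = s≤s (T⊑S u r n<u+r)
  ... | yes u≤s | no  u≰t
    rewrite #taken-∷-inside r fs u≤s (≤-<-trans (Free⇒≤n fs) n<u+r)
          | #taken-∷-below T r (≰⇒> u≰t) = m≤n⇒m≤1+n (T⊑S u r n<u+r)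
  ... | no  u≰s | yes u≤t
    rewrite #taken-∷-below S r (≰⇒> u≰s)
          | #taken-∷-inside r ft u≤t (≤-<-trans (Free⇒≤n ft) n<u+r) = strict (≰⇒> u≰s) u≤t n<u+r
  ... | no  u≰s | no  u≰t
    rewrite #taken-∷-below S r (≰⇒> u≰s) | #taken-∷-below T r (≰⇒> u≰t) = T⊑S u r n<u+r

  Sparser-∷-≤ : ∀ {a b} → Free S a → Free S b → a ≤ b → Sparser (a ∷ S) (b ∷ S)
  Sparser-∷-≤ fa fb a≤b = Sparser-∷ (↭⇒Sparser ↭-refl) fa fb
    (λ b<u u≤a _ → contradiction (≤-trans u≤a a≤b) (<⇒≱ b<u))

  Sparser-strict-below : ∀ {s u r} → Sparser T S → Free S s → s < u → AllTaken T s u → n < u + r →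
                         #taken T u r < #taken S u r
  Sparser-strict-below {T} {S} {s} {u} {r} T⊑S fs s<u full n<u+r
    with d , refl ← m≤n⇒∃[o]m+o≡n (<⇒≤ s<u) = +-cancelˡ-≤ (#taken S s d) _ _ (begin
      #taken S s d + suc (#taken T u r)  ≡⟨ +-suc _ _ ⟩
      suc (#taken S s d) + #taken T u r  ≤⟨ +-monoˡ-≤ _ (#taken< d fs ≤-refl s<u) ⟩
      d + #taken T u r                   ≡⟨ cong (_+ #taken T u r) (sym (#taken-full d full)) ⟩
      #taken T s d + #taken T u r        ≡⟨ sym (#taken-+ T s d r) ⟩
      #taken T s (d + r)                 ≤⟨ T⊑S s (d + r) (subst (n <_) (+-assoc s d r) n<u+r) ⟩
      #taken S s (d + r)                 ≡⟨ #taken-+ S s d r ⟩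
      #taken S s d + #taken S u r        ∎)
    where open ≤-Reasoning

  Sparser-strict-above : ∀ {w u r} → Sparser T S → Free T w → u ≤ w → AllTaken S u (suc w) → n < u + r →
                         #taken T u r < #taken S u r
  Sparser-strict-above {T} {S} {w} {u} {r} T⊑S fw u≤w full n<u+r
    with e , refl ← m≤n⇒∃[o]m+o≡n u≤w
    with r′ , refl ← m≤n⇒∃[o]m+o≡n (+-cancelˡ-< u e r (≤-<-trans (Free⇒≤n fw) n<u+r)) = begin
      suc (#taken T u (d + r′))
        ≡⟨ cong suc (#taken-+ T u d r′) ⟩
      suc (#taken T u d) + #taken T (u + d) r′
        ≤⟨ +-monoˡ-≤ _ (#taken< d fw (m≤m+n u e) (≤-reflexive (sym (+-suc u e)))) ⟩
      d + #taken T (u + d) r′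
        ≤⟨ +-monoʳ-≤ d (T⊑S (u + d) r′ (subst (n <_) (sym (+-assoc u d r′)) n<u+r)) ⟩
      d + #taken S (u + d) r′
        ≡⟨ cong (_+ #taken S (u + d) r′) (sym (#taken-full d full′)) ⟩
      #taken S u d + #taken S (u + d) r′
        ≡⟨ sym (#taken-+ S u d r′) ⟩
      #taken S u (d + r′)
        ∎
    where
    open ≤-Reasoning
    d = suc e
    full′ : AllTaken S u (u + d)
    full′ = AllTaken-shrink ≤-refl (≤-reflexive (+-suc u e)) full

  module _ (k : ℕ) where

    data ParksAt (X : List ℕ) (a s : ℕ) : Set where
      backward : a ∸ k ≤ s → s ≤ a → AllTaken X (suc s) (suc a) → Free X s → ParksAt X a s
      forward  : a < s → AllTaken X (a ∸ k) s → Free X s → ParksAt X a s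

    ParksAt-free : ∀ {a s} → ParksAt X a s → Free X s
    ParksAt-free (backward _ _ _ fs) = fs
    ParksAt-free (forward _ _ fs)    = fs

    ParksAt-reach : ∀ {a s} → ParksAt X a s → a ∸ k ≤ s
    ParksAt-reach (backward a∸k≤s _ _ _)      = a∸k≤s
    ParksAt-reach {a = a} (forward a<s _ _) = ≤-trans (m∸n≤m a k) (<⇒≤ a<s)

    ParksAt-mono : ∀ {p q t s} → p ≤ q → ParksAt X p t → ParksAt X q s → t ≤ s
    ParksAt-mono {p = p} {q} {t} {s} p≤q pt qs = ≮⇒≥ (clash pt qs)
      where
      clash : ParksAt X p t → ParksAt X q s → ¬ s < t
      clash (backward _ t≤p _ ft) (backward _ _ gap _) s<t = ft (gap s<t (s≤s (≤-trans t≤p p≤q)))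
      clash (backward _ t≤p _ _)  (forward q<s _ _)    s<t = <⇒≱ (<-trans q<s s<t) (≤-trans t≤p p≤q)
      clash (forward _ gap _) (backward q∸k≤s _ _ fs) s<t =
        fs (gap (≤-trans (∸-monoˡ-≤ k p≤q) q∸k≤s) s<t)
      clash (forward _ gap _) (forward q<s _ fs)      s<t =
        fs (gap (≤-trans (m∸n≤m p k) (≤-trans p≤q (<⇒≤ q<s))) s<t)

    ParksAt-∷ : ∀ {a s z} → s ≢ z → ParksAt X a s → ParksAt (z ∷ X) a s
    ParksAt-∷ s≢z (backward a∸k≤s s≤a gap fs) = backward a∸k≤s s≤a (AllTaken-∷ gap) (Free-∷ s≢z fs)
    ParksAt-∷ s≢z (forward a<s gap fs)        = forward a<s (AllTaken-∷ gap) (Free-∷ s≢z fs)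

    parkSpot-sound : ∀ X a {s} → parkSpot k n X a ≡ just s → ParksAt X a s
    parkSpot-sound X a eq with free n X a in fa
    ... | true with refl ← eq = backward (m∸n≤m a k) ≤-refl AllTaken-empty (free≡true⇒Free fa)
    ... | false with backStep n X (a ∸ 1) k in back
    ...   | just t with refl ← eq with backStep-just a k back
    ...     | a∸k≤t , t<a , gap , ft =
      backward a∸k≤t (<⇒≤ t<a) (AllTaken-join gap (AllTaken-single (taken fa))) ft
    parkSpot-sound X a eq | false | nothing with forwardStep-just (suc a) (n ∸ a) eq
    ... | a<s , gap , fs = forward a<s (AllTaken-join below gap) fs
      where below = AllTaken-join (backStep-nothing a k back) (AllTaken-single (taken fa))

    parkSpot-free : ∀ X a {s} → parkSpot k n X a ≡ just s → Free X s
    parkSpot-free X a eq = ParksAt-free (parkSpot-sound X a eq)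

    parkSpot-nothing : ∀ X a → parkSpot k n X a ≡ nothing → AllTaken X (a ∸ k) h
    parkSpot-nothing X a eq with free n X a in fa
    ... | false with backStep n X (a ∸ 1) k in back
    ...   | nothing = AllTaken-extend (AllTaken-shrink ≤-refl (s≤s (m≤n+m∸n n a))
              (AllTaken-join (AllTaken-join (backStep-nothing a k back) (AllTaken-single (taken fa)))
                             (forwardStep-nothing (suc a) (n ∸ a) eq)))

    parkSpot-just : ∀ a {w} → Free X w → a ∸ k ≤ w → ∃[ s ] parkSpot k n X a ≡ just s
    parkSpot-just {X} a fw a∸k≤w with parkSpot k n X a in eq
    ... | just s  = s , refl
    ... | nothing = contradiction (parkSpot-nothing X a eq a∸k≤w (n<1+n _)) fw

    parkSpot-complete : ∀ {a s} → ParksAt X a s → parkSpot k n X a ≡ just s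
    parkSpot-complete {X} {a} as with parkSpot-just a (ParksAt-free as) (ParksAt-reach as)
    ... | t , eq =
      trans eq (cong just (≤-antisym (ParksAt-mono ≤-refl at as) (ParksAt-mono ≤-refl as at)))
      where at = parkSpot-sound X a eq

    parkSpot-∷ : ∀ X a {s z} → parkSpot k n X a ≡ just s → s ≢ z → parkSpot k n (z ∷ X) a ≡ just s
    parkSpot-∷ X a eq s≢z = parkSpot-complete (ParksAt-∷ s≢z (parkSpot-sound X a eq))

    parkSpot-mono : ∀ X {p q s} → p ≤ q → parkSpot k n X q ≡ just s →
                    ∃[ t ] parkSpot k n X p ≡ just t × t ≤ s
    parkSpot-mono X {p} {q} p≤q eq
      with parkSpot-just p (ParksAt-free qs) (≤-trans (∸-monoˡ-≤ k p≤q) (ParksAt-reach qs))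
      where qs = parkSpot-sound X q eq
    ... | t , eq′ = t , eq′ , ParksAt-mono p≤q (parkSpot-sound X p eq′) (parkSpot-sound X q eq)

    ParksAt-Sparser-strict : ∀ {x s t u r} → Sparser T S → ParksAt S x s → ParksAt T x t →
                             s < u → u ≤ t → n < u + r → #taken T u r < #taken S u r
    ParksAt-Sparser-strict T⊑S (backward _ _ gapS _) (backward _ t≤x _ ft) s<u u≤t =
      Sparser-strict-above T⊑S ft u≤t (AllTaken-shrink s<u (s≤s t≤x) gapS)
    ParksAt-Sparser-strict T⊑S (backward x∸k≤s _ _ fs) (forward _ gapT _) s<u u≤t =
      Sparser-strict-below T⊑S fs s<u (AllTaken-shrink x∸k≤s u≤t gapT)
    ParksAt-Sparser-strict T⊑S (forward x<s _ _) (backward _ t≤x _ _) s<u u≤t =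
      contradiction (<-≤-trans s<u (≤-trans u≤t t≤x)) (<⇒≯ x<s)
    ParksAt-Sparser-strict {x = x} T⊑S (forward x<s _ fs) (forward _ gapT _) s<u u≤t =
      Sparser-strict-below T⊑S fs s<u (AllTaken-shrink (≤-trans (m∸n≤m x k) (<⇒≤ x<s)) u≤t gapT)

    parkSpot-Sparser : ∀ T S x {s} → Sparser T S → parkSpot k n S x ≡ just s →
                       ∃[ t ] parkSpot k n T x ≡ just t × Sparser (t ∷ T) (s ∷ S)
    parkSpot-Sparser T S x T⊑S eq with parkSpot k n T x in eqT
    ... | just t =
      t , refl , Sparser-∷ T⊑S (ParksAt-free xt) (ParksAt-free xs) (ParksAt-Sparser-strict T⊑S xs xt)
      where xs = parkSpot-sound S x eq
            xt = parkSpot-sound T x eqT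
    ... | nothing = ⊥-elim (<-irrefl refl (begin-strict
          suc n                    ≡⟨ sym (#taken-full (suc n) (parkSpot-nothing T x eqT)) ⟩
          #taken T (x ∸ k) (suc n) ≤⟨ T⊑S (x ∸ k) (suc n) reaches ⟩
          #taken S (x ∸ k) (suc n) <⟨ #taken< (suc n) fs (ParksAt-reach xs) (<-≤-trans (s≤s (Free⇒≤n fs)) reaches) ⟩
          suc n                    ∎))
      where
      open ≤-Reasoning
      xs = parkSpot-sound S x eq
      fs = parkSpot-free S x eq
      reaches : suc n ≤ x ∸ k + suc n
      reaches = m≤n+m (suc n) (x ∸ k)

    parkAll-∷⁻ : ∀ S a ρ → parkAll k n S (a ∷ ρ) ≡ true →
                 ∃[ s ] parkSpot k n S a ≡ just s × parkAll k n (s ∷ S) ρ ≡ true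
    parkAll-∷⁻ S a ρ run with parkSpot k n S a
    ... | just s = s , refl , run

    parkAll-∷⁺ : ∀ S a ρ {s} → parkSpot k n S a ≡ just s → parkAll k n (s ∷ S) ρ ≡ true →
                 parkAll k n S (a ∷ ρ) ≡ true
    parkAll-∷⁺ S a ρ eq run rewrite eq = run

    parkAll-Sparser : ∀ T S ρ → Sparser T S → parkAll k n S ρ ≡ true → parkAll k n T ρ ≡ true
    parkAll-Sparser T S []      _   _   = refl
    parkAll-Sparser T S (a ∷ ρ) T⊑S run with parkAll-∷⁻ S a ρ run
    ... | s , a↦s , run′ with parkSpot-Sparser T S a T⊑S a↦s
    ...   | t , a↦t , T′⊑S′ = parkAll-∷⁺ T a ρ a↦t (parkAll-Sparser (t ∷ T) (s ∷ S) ρ T′⊑S′ run′)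

    -- Moved in front of p, the car q parks where it did after p unless that is p's spot s₁. If so, p
    -- now parks no higher than q did, which leaves a sparser street; otherwise the cars trade spots.
    parkAll-swap : ∀ S p q ρ → p ≤ q →
                   parkAll k n S (p ∷ q ∷ ρ) ≡ true → parkAll k n S (q ∷ p ∷ ρ) ≡ true
    parkAll-swap S p q ρ p≤q run
      with s₁ , p↦s₁ , run₁ ← parkAll-∷⁻ S p (q ∷ ρ) run
      with s₂ , q↦s₂ , run₂ ← parkAll-∷⁻ (s₁ ∷ S) q ρ run₁
      with t₁ , q↦t₁ , _ ← parkSpot-Sparser S (s₁ ∷ S) q (Sparser-occupy (parkSpot-free S p p↦s₁)) q↦s₂
      with t₁ ≟ s₁
    ... | yes refl with t₂ , p↦t₂ , t₂≤s₂ ← parkSpot-mono (t₁ ∷ S) p≤q q↦s₂ =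
      parkAll-∷⁺ S q (p ∷ ρ) q↦t₁ (parkAll-∷⁺ (t₁ ∷ S) p ρ p↦t₂ (parkAll-Sparser _ _ ρ
        (Sparser-∷-≤ (parkSpot-free (t₁ ∷ S) p p↦t₂) (parkSpot-free (t₁ ∷ S) q q↦s₂) t₂≤s₂) run₂))
    ... | no t₁≢s₁ with refl ← trans (sym q↦s₂) (parkSpot-∷ S q q↦t₁ t₁≢s₁) =
      parkAll-∷⁺ S q (p ∷ ρ) q↦t₁ (parkAll-∷⁺ (t₁ ∷ S) p ρ (parkSpot-∷ S p p↦s₁ (≢-sym t₁≢s₁))
        (parkAll-Sparser _ _ ρ (↭⇒Sparser (↭-swap s₁ t₁ ↭-refl)) run₂))

    parkAll-postpone : ∀ S m γ δ → All (m ≤_) γ → parkAll k n S (m ∷ γ ++ δ) ≡ true →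
                       parkAll k n S (γ ++ m ∷ δ) ≡ true
    parkAll-postpone S m []      δ []           run = run
    parkAll-postpone S m (g ∷ γ) δ (m≤g ∷ m≤γ) run
      with parkAll-∷⁻ S g (m ∷ γ ++ δ) (parkAll-swap S m g (γ ++ δ) m≤g run)
    ... | s , g↦s , run′ = parkAll-∷⁺ S g (γ ++ m ∷ δ) g↦s (parkAll-postpone (s ∷ S) m γ δ m≤γ run′)

    parkAll-↭-sorted : ∀ S σ β → AllPairs _≤_ σ → β ↭ σ → parkAll k n S σ ≡ true → parkAll k n S β ≡ true
    parkAll-↭-sorted S [] β [] β↭[] _ with refl ← ↭-empty-inv β↭[] = refl
    parkAll-↭-sorted S (m ∷ σ) β (m≤σ ∷ σ↑) β↭mσ run
      with β₁ , β₂ , refl ← ∈-∃++ (∈-resp-↭ (↭-sym β↭mσ) (here refl))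
      with s , m↦s , run′ ← parkAll-∷⁻ S m σ run =
      parkAll-postpone S m β₁ β₂ (++⁻ˡ β₁ (All-resp-↭ (↭-sym β₁β₂↭σ) m≤σ))
        (parkAll-∷⁺ S m (β₁ ++ β₂) m↦s (parkAll-↭-sorted (s ∷ S) σ (β₁ ++ β₂) σ↑ β₁β₂↭σ run′))
      where
      β₁β₂↭σ : β₁ ++ β₂ ↭ σ
      β₁β₂↭σ = drop-mid β₁ [] β↭mσ

theorem2p4 : (k n : ℕ) → k ≥ 1 → (α : List ℕ) → IsPreference n α →
    (αasc : List ℕ) → αasc ↭ α → Sorted αasc →
    (((β : List ℕ) → β ↭ α → IsNaplesPF k n β) ⇔ IsNaplesPF k n αasc)
theorem2p4 k n _ α _ αasc αasc↭α αasc↑ = mk⇔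
  (λ allPark → allPark αasc αasc↭α)
  (λ ascParks β β↭α → parkAll-↭-sorted n k [] αasc β (Linked⇒AllPairs ≤-trans αasc↑)
                        (↭-trans β↭α (↭-sym αasc↭α)) ascParks)
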